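{- Let $m,n\in\mathbb{N}$ with $n>1$ and $m=\omega(n)$. Then the following two statements are equivalent: (2) there exist $a_i\in\{1,\dots,p_i-1\}$, $i=2,\dots,n$, such that for every $q\in\{1,\dots,m\}$ there is $i\in\{2,\dots,n\}$ with $q\equiv a_i\pmod{p_i}$; (3) there exist a permutation $(\pi_2,\dots,\pi_n)$ of $\{p_2,\dots,p_n\}$ and integers $q_2,\dots,q_n\in\{1,\dots,m\}$ such that $q_i\not\equiv 0\pmod{\pi_i}$ for $i=2,\dots,n$; $i<j\Rightarrow q_i<q_j$ for $i,j\in\{2,\dots,n\}$; $q_2=1$; $q_i=\min\{j\in\{1,\dots,m\}\mid \forall k<i: j\not\equiv q_k\pmod{\pi_k}\}$ for $i=3,\dots,n$; and for every $q\in\{1,\dots,m\}$ there is $i\in\{2,\dots,n\}$ with $q\equiv q_i\pmod{\pi_i}$.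
   Context: Let $p_1=2,p_2=3,p_3=5,\dots$ be the primes in increasing order. For $n>1$, $\omega(n)$ denotes the greatest length of a sequence of consecutive integers each of which is divisible by at least one of the primes $p_2,\dots,p_n$. -}

module Defs where

open import Data.Nat as ℕ using (ℕ; _≤_; _<_; _∸_)
open import Data.Nat.Primality using (Prime)
open import Data.Integer as ℤ using (ℤ; +_)
open import Data.Integer.Divisibility as ℤD using ()
open import Data.Product using (Σ; ∃; _×_; _,_)
open import Relation.Binary.PropositionalEquality using (_≡_)
open import Relation.Nullary using (¬_)

-- P enumerates the primes in increasing order starting at index 1:
-- P 1 = 2, P 2 = 3, P 3 = 5, ...  (P 0 is irrelevant).
-- These conditions determine P i uniquely for every i ≥ 1.
record IsPrimeEnumeration (P : ℕ → ℕ) : Set where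
  field
    prime      : ∀ i → 1 ≤ i → Prime (P i)
    increasing : ∀ i j → 1 ≤ i → i < j → P i < P j
    exhaustive : ∀ p → Prime p → Σ ℕ λ i → 1 ≤ i × P i ≡ p

_≡ᶻ_[mod_] : ℤ → ℤ → ℕ → Set
a ≡ᶻ b [mod d ] = (+ d) ℤD.∣ (a ℤ.- b)

_≡_[mod_] : ℕ → ℕ → ℕ → Set
a ≡ b [mod d ] = (+ a) ≡ᶻ (+ b) [mod d ]

CoveredBy : (P : ℕ → ℕ) → ℕ → ℤ → Set
CoveredBy P n x = Σ ℕ λ i → 2 ≤ i × i ≤ n × x ≡ᶻ + 0 [mod P i ]

CoveredRun : (P : ℕ → ℕ) → ℕ → ℤ → ℕ → Set
CoveredRun P n a L = ∀ k → k < L → CoveredBy P n (a ℤ.+ + k)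

IsOmega : (P : ℕ → ℕ) → ℕ → ℕ → Set
IsOmega P n m =
  (Σ ℤ λ a → CoveredRun P n a m) ×
  (∀ (a : ℤ) (L : ℕ) → CoveredRun P n a L → L ≤ m)

Statement2 : (P : ℕ → ℕ) → ℕ → ℕ → Set
Statement2 P n m =
  Σ (ℕ → ℕ) λ a →
    (∀ i → 2 ≤ i → i ≤ n → 1 ≤ a i × a i ≤ P i ∸ 1) ×
    (∀ q → 1 ≤ q → q ≤ m →
       Σ ℕ λ i → 2 ≤ i × i ≤ n × q ≡ a i [mod P i ])

IsPermOfPrimes : (P : ℕ → ℕ) → ℕ → (ℕ → ℕ) → Set
IsPermOfPrimes P n π =
  (∀ i → 2 ≤ i → i ≤ n → Σ ℕ λ j → 2 ≤ j × j ≤ n × π i ≡ P j) ×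
  (∀ i j → 2 ≤ i → i ≤ n → 2 ≤ j → j ≤ n → π i ≡ π j → i ≡ j) ×
  (∀ j → 2 ≤ j → j ≤ n → Σ ℕ λ i → 2 ≤ i × i ≤ n × π i ≡ P j)

Avoids : (π q : ℕ → ℕ) → ℕ → ℕ → ℕ → Set
Avoids π q m i j =
  1 ≤ j × j ≤ m × (∀ k → 2 ≤ k → k < i → ¬ (j ≡ q k [mod π k ]))

IsMin : (ℕ → Set) → ℕ → Set
IsMin S x = S x × (∀ y → S y → x ≤ y)

Statement3 : (P : ℕ → ℕ) → ℕ → ℕ → Set
Statement3 P n m =
  Σ (ℕ → ℕ) λ π → Σ (ℕ → ℕ) λ q →
    IsPermOfPrimes P n π ×
    (∀ i → 2 ≤ i → i ≤ n → 1 ≤ q i × q i ≤ m) ×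
    (∀ i → 2 ≤ i → i ≤ n → ¬ (q i ≡ 0 [mod π i ])) ×
    (∀ i j → 2 ≤ i → i ≤ n → 2 ≤ j → j ≤ n → i < j → q i < q j) ×
    q 2 ≡ 1 ×
    (∀ i → 3 ≤ i → i ≤ n → IsMin (Avoids π q m i) (q i)) ×
    (∀ r → 1 ≤ r → r ≤ m →
       Σ ℕ λ i → 2 ≤ i × i ≤ n × r ≡ q i [mod π i ])

{-# OPTIONS --safe #-}
-- (3) ⇒ (2): put a_j := q_i mod p_j, where π_i = p_j.
-- (2) ⇒ (3): sieve greedily. At each step let q be the least number in [1, m] not yet hit by
-- the residue classes a_i mod p_i chosen so far, and choose the first prime p_i whose class
-- contains q. A step never runs out of such q while some prime is still unused: residue classes
-- hitting every number of [1, L] yield, by the Chinese remainder theorem, an x such that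
-- x, x + 1, ..., x + L - 1 are each divisible by one of the primes, so the unused prime could
-- hit m + 1 as well and ω(n) ≥ m + 1. Hence the greedy sieve uses every prime exactly once,
-- which gives the permutation π and the increasing sequence q.
module Submission where

open import Data.Integer as ℤ using (ℤ; +_; 0ℤ; 1ℤ; -_)
open import Data.Integer.Divisibility.Signed as ℤ∣ using (∣ᵤ⇒∣; ∣⇒∣ᵤ; ∣m∣n⇒∣m+n)
import Data.Integer.Properties as ℤP
open import Data.Integer.Tactic.RingSolver using (solve-∀)
open import Data.List using (List; []; _∷_; length; applyUpTo)
open import Data.List.Membership.Propositional using (_∈_; _∉_; find; lose)
open import Data.List.Membership.Propositional.Properties using (∈-applyUpTo⁺; ∈-applyUpTo⁻)
open import Data.List.Properties using (length-removeAt′; length-applyUpTo)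
open import Data.List.Relation.Binary.Subset.Propositional using (_⊆_)
open import Data.List.Relation.Binary.Subset.Propositional.Properties using (Any-resp-⊆)
import Data.List.Relation.Unary.All as All
open import Data.List.Relation.Unary.All.Properties using (¬Any⇒All¬)
open import Data.List.Relation.Unary.Any as Any using (Any; here; there; _─_)
open import Data.List.Relation.Unary.Unique.Propositional using (Unique; []; _∷_)
open import Data.List.Relation.Unary.Unique.Propositional.Properties using (applyUpTo⁺₁)
open import Data.Nat using (ℕ; zero; suc; _+_; _*_; _∸_; _≤_; _<_; z≤n; s≤s; NonZero; nonTrivial⇒≢1; >-nonZero)
open import Data.Nat.Coprimality using (Coprime; coprime-Bézout)
import Data.Nat.Divisibility as ℕ∣
open import Data.Nat.DivMod using (_%_; _/_; m≡m%n+[m/n]*n; m%n<n)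
open import Data.Nat.GCD using (module Bézout)
open import Data.Nat.Primality using (Prime; prime⇒irreducible; prime⇒nonTrivial; prime⇒nonZero; euclidsLemma)
open import Data.Nat.Properties
open import Data.List.Membership.DecPropositional _≟_ using (_∈?_)
open import Data.Product using (Σ; ∃; ∃₂; _×_; _,_; proj₁; proj₂)
open import Data.Sum using (inj₁; inj₂)
open import Function using (_∘_)
open import Function.Bundles using (_⇔_; mk⇔)
open import Relation.Binary.Definitions using (tri<; tri≈; tri>)
open import Relation.Binary.PropositionalEquality
open import Relation.Nullary using (¬_; ¬?; Dec; contradiction; yes; no)
open import Relation.Nullary.Decidable using (decidable-stable)
open import Relation.Unary using (Decidable)

open import Defs

≡ᶻ⇒∣ : ∀ {a b d} → a ≡ᶻ b [mod d ] → + d ℤ∣.∣ a ℤ.- b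
≡ᶻ⇒∣ = ∣ᵤ⇒∣

∣⇒≡ᶻ : ∀ {a b d} → + d ℤ∣.∣ a ℤ.- b → a ≡ᶻ b [mod d ]
∣⇒≡ᶻ = ∣⇒∣ᵤ

≡ᶻ-refl : ∀ {a d} → a ≡ᶻ a [mod d ]
≡ᶻ-refl {a} {d} = ∣⇒≡ᶻ {a} {a} {d} (ℤ∣.divides 0ℤ (ℤP.+-inverseʳ a))

≡ᶻ-sym : ∀ {a b d} → a ≡ᶻ b [mod d ] → b ≡ᶻ a [mod d ]
≡ᶻ-sym {a} {b} {d} a≡b =
  ∣⇒≡ᶻ {b} {a} {d} (subst (+ d ℤ∣.∣_) (negate a b) (ℤ∣.∣m⇒∣-m (≡ᶻ⇒∣ {a} {b} a≡b)))
  where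
  negate : ∀ a b → - (a ℤ.- b) ≡ b ℤ.- a
  negate = solve-∀

≡ᶻ-trans : ∀ {a b c d} → a ≡ᶻ b [mod d ] → b ≡ᶻ c [mod d ] → a ≡ᶻ c [mod d ]
≡ᶻ-trans {a} {b} {c} {d} a≡b b≡c = ∣⇒≡ᶻ {a} {c} {d}
  (subst (+ d ℤ∣.∣_) (ℤP.+-minus-telescope a b c)
    (∣m∣n⇒∣m+n (≡ᶻ⇒∣ {a} {b} a≡b) (≡ᶻ⇒∣ {b} {c} b≡c)))

≡0[mod]⇒∣ : ∀ {a d} → a ≡ 0 [mod d ] → d ℕ∣.∣ a
≡0[mod]⇒∣ {a} {d} = subst (d ℕ∣.∣_) (cong ℤ.∣_∣ (ℤP.+-identityʳ (+ a)))

residue≢0 : ∀ {r d} → 1 ≤ r → r ≤ d ∸ 1 → ¬ r ≡ 0 [mod d ]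
residue≢0 {d = zero}  1≤r r≤0 _   = contradiction (≤-trans 1≤r r≤0) λ ()
residue≢0 {d = suc d} 1≤r r≤d r≡0 =
  n≮n d (≤-trans (ℕ∣.∣⇒≤ {{>-nonZero 1≤r}} (≡0[mod]⇒∣ r≡0)) r≤d)

≡%[mod] : ∀ x d .{{_ : NonZero d}} → x ≡ x % d [mod d ]
≡%[mod] x d = ∣⇒≡ᶻ {+ x} {+ (x % d)} {d} (ℤ∣.divides (+ (x / d)) (begin
  + x ℤ.- + (x % d)                             ≡⟨ cong (λ z → + z ℤ.- + (x % d)) (m≡m%n+[m/n]*n x d) ⟩
  + (x % d) ℤ.+ + (x / d * d) ℤ.- + (x % d)     ≡⟨ cong (λ z → + (x % d) ℤ.+ z ℤ.- + (x % d)) (ℤP.pos-* (x / d) d) ⟩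
  + (x % d) ℤ.+ + (x / d) ℤ.* + d ℤ.- + (x % d) ≡⟨ complement (+ (x % d)) (+ (x / d) ℤ.* + d) ⟩
  + (x / d) ℤ.* + d                             ∎))
  where
  open ≡-Reasoning
  complement : ∀ r s → r ℤ.+ s ℤ.- r ≡ s
  complement = solve-∀

≡1-b⇒+k≡0 : ∀ {x : ℤ} {k b d : ℕ} → x ≡ᶻ 1ℤ ℤ.- + b [mod d ] → suc k ≡ b [mod d ] →
            (x ℤ.+ + k) ≡ᶻ 0ℤ [mod d ]
≡1-b⇒+k≡0 {x} {k} {b} {d} x≡1-b 1+k≡b = ∣⇒≡ᶻ {x ℤ.+ + k} {0ℤ} {d}
  (subst (+ d ℤ∣.∣_) (split x (+ k) (+ b))
    (∣m∣n⇒∣m+n (≡ᶻ⇒∣ {x} {1ℤ ℤ.- + b} x≡1-b) (≡ᶻ⇒∣ {+ suc k} {+ b} 1+k≡b)))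
  where
  split : ∀ x k b → x ℤ.- (1ℤ ℤ.- b) ℤ.+ (1ℤ ℤ.+ k ℤ.- b) ≡ x ℤ.+ k ℤ.- 0ℤ
  split = solve-∀

≡[mod]? : ∀ a b d → Dec (a ≡ b [mod d ])
≡[mod]? a b d = d ℕ∣.∣? ℤ.∣ + a ℤ.- + b ∣

bézout : ∀ {m n} → Coprime m n → ∃₂ λ u v → u ℤ.* + m ℤ.+ v ℤ.* + n ≡ 1ℤ
bézout {m} {n} coprime = fromIdentity (coprime-Bézout coprime)
  where
  open ≡-Reasoning
  toℤ : ∀ a b c d → 1 + a * b ≡ c * d → 1ℤ ℤ.+ + a ℤ.* + b ≡ + c ℤ.* + d
  toℤ a b c d eq =
    trans (cong (λ z → 1ℤ ℤ.+ z) (sym (ℤP.pos-* a b))) (trans (cong +_ eq) (ℤP.pos-* c d))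
  cancelʳ : ∀ y n → 1ℤ ℤ.+ y ℤ.* n ℤ.+ - y ℤ.* n ≡ 1ℤ
  cancelʳ = solve-∀
  cancelˡ : ∀ x m → - x ℤ.* m ℤ.+ (1ℤ ℤ.+ x ℤ.* m) ≡ 1ℤ
  cancelˡ = solve-∀
  fromIdentity : Bézout.Identity 1 m n → ∃₂ λ u v → u ℤ.* + m ℤ.+ v ℤ.* + n ≡ 1ℤ
  fromIdentity (Bézout.+- x y eq) = + x , - + y , (begin
    + x ℤ.* + m ℤ.+ - + y ℤ.* + n           ≡⟨ cong (ℤ._+ - + y ℤ.* + n) (sym (toℤ y n x m eq)) ⟩
    1ℤ ℤ.+ + y ℤ.* + n ℤ.+ - + y ℤ.* + n    ≡⟨ cancelʳ (+ y) (+ n) ⟩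
    1ℤ                                      ∎)
  fromIdentity (Bézout.-+ x y eq) = - + x , + y , (begin
    - + x ℤ.* + m ℤ.+ + y ℤ.* + n           ≡⟨ cong (λ z → - + x ℤ.* + m ℤ.+ z) (sym (toℤ x m y n eq)) ⟩
    - + x ℤ.* + m ℤ.+ (1ℤ ℤ.+ + x ℤ.* + m)  ≡⟨ cancelˡ (+ x) (+ m) ⟩
    1ℤ                                      ∎)

crt₂ : ∀ {M p} → Coprime M p → ∀ x c → ∃ λ y → + M ℤ∣.∣ y ℤ.- x × y ≡ᶻ c [mod p ]
crt₂ {M} {p} coprime x c with bézout coprime
... | u , v , uM+vp≡1 = y , ℤ∣.divides ((c ℤ.- x) ℤ.* u) (step-x x c u (+ M))
                          , ∣⇒≡ᶻ {y} {c} {p} (ℤ∣.divides ((x ℤ.- c) ℤ.* v) y-c)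
  where
  open ≡-Reasoning
  y = x ℤ.+ (c ℤ.- x) ℤ.* u ℤ.* + M
  step-x : ∀ x c u M → x ℤ.+ (c ℤ.- x) ℤ.* u ℤ.* M ℤ.- x ≡ (c ℤ.- x) ℤ.* u ℤ.* M
  step-x = solve-∀
  step-c : ∀ x c u M → x ℤ.+ (c ℤ.- x) ℤ.* u ℤ.* M ℤ.- c ≡ (x ℤ.- c) ℤ.* (1ℤ ℤ.- u ℤ.* M)
  step-c = solve-∀
  complement : ∀ a b → a ℤ.+ b ℤ.- a ≡ b
  complement = solve-∀
  y-c : y ℤ.- c ≡ (x ℤ.- c) ℤ.* v ℤ.* + p
  y-c = begin
    y ℤ.- c                                        ≡⟨ step-c x c u (+ M) ⟩
    (x ℤ.- c) ℤ.* (1ℤ ℤ.- u ℤ.* + M)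
      ≡⟨ cong (λ z → (x ℤ.- c) ℤ.* (z ℤ.- u ℤ.* + M)) (sym uM+vp≡1) ⟩
    (x ℤ.- c) ℤ.* (u ℤ.* + M ℤ.+ v ℤ.* + p ℤ.- u ℤ.* + M)
      ≡⟨ cong ((x ℤ.- c) ℤ.*_) (complement (u ℤ.* + M) (v ℤ.* + p)) ⟩
    (x ℤ.- c) ℤ.* (v ℤ.* + p)                      ≡⟨ sym (ℤP.*-assoc (x ℤ.- c) v (+ p)) ⟩
    (x ℤ.- c) ℤ.* v ℤ.* + p                        ∎

prime≢1 : ∀ {p} → Prime p → p ≢ 1
prime≢1 p-prime = nonTrivial⇒≢1 {{prime⇒nonTrivial p-prime}}

module ChineseRemainder (p : ℕ → ℕ) (p-prime : ∀ i → Prime (p i))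
                        (p-injective : ∀ {i j} → p i ≡ p j → i ≡ j) where

  ∏ : ℕ → ℕ
  ∏ zero = 1
  ∏ (suc N) = ∏ N * p N

  p∣∏ : ∀ {i N} → i < N → p i ℕ∣.∣ ∏ N
  p∣∏ {i} {suc N} (s≤s i≤N) with m≤n⇒m<n∨m≡n i≤N
  ... | inj₁ i<N  = ℕ∣.∣m⇒∣m*n (p N) (p∣∏ i<N)
  ... | inj₂ refl = ℕ∣.n∣m*n (∏ N)

  p∤∏ : ∀ {j N} → N ≤ j → ¬ p j ℕ∣.∣ ∏ N
  p∤∏ {j} {zero} _ pj∣1 = prime≢1 (p-prime j) (ℕ∣.∣1⇒≡1 pj∣1)
  p∤∏ {j} {suc N} N<j pj∣∏ with euclidsLemma (∏ N) (p N) (p-prime j) pj∣∏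
  ... | inj₁ pj∣∏N = p∤∏ (<⇒≤ N<j) pj∣∏N
  ... | inj₂ pj∣pN with prime⇒irreducible (p-prime N) pj∣pN
  ...   | inj₁ pj≡1  = prime≢1 (p-prime j) pj≡1
  ...   | inj₂ pj≡pN = <⇒≢ N<j (sym (p-injective pj≡pN))

  ∏-coprime : ∀ N → Coprime (∏ N) (p N)
  ∏-coprime N (d∣∏ , d∣pN) with prime⇒irreducible (p-prime N) d∣pN
  ... | inj₁ d≡1  = d≡1
  ... | inj₂ refl = contradiction d∣∏ (p∤∏ ≤-refl)

  crt : ∀ N (c : ℕ → ℤ) → ∃ λ x → ∀ i → i < N → x ≡ᶻ c i [mod p i ]
  crt zero    c = 0ℤ , λ _ ()
  crt (suc N) c = y , y≡c
    where
    x = proj₁ (crt N c)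
    step = crt₂ (∏-coprime N) x (c N)
    y = proj₁ step
    y≡c : ∀ i → i < suc N → y ≡ᶻ c i [mod p i ]
    y≡c i (s≤s i≤N) with m≤n⇒m<n∨m≡n i≤N
    ... | inj₁ i<N  = ≡ᶻ-trans {y} {x} {c i} {p i}
                        (∣⇒≡ᶻ {y} {x} {p i} (ℤ∣.∣-trans (∣ᵤ⇒∣ (p∣∏ i<N)) (proj₁ (proj₂ step))))
                        (proj₂ (crt N c) i i<N)
    ... | inj₂ refl = proj₂ (proj₂ step)

module BoundedSearch {Q : ℕ → Set} (Q? : Decidable Q) where

  -- the least j ∈ [s, s + c) with Q j, and s + c if there is none
  least : ℕ → ℕ → ℕ
  least s zero    = s
  least s (suc c) with Q? s
  ... | yes _ = s
  ... | no  _ = least (suc s) c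

  least-≥ : ∀ s c → s ≤ least s c
  least-≥ s zero    = ≤-refl
  least-≥ s (suc c) with Q? s
  ... | yes _ = ≤-refl
  ... | no  _ = <⇒≤ (least-≥ (suc s) c)

  least-found : ∀ s c → least s c < s + c → Q (least s c)
  least-found s zero    l<s+0 = contradiction (subst (s <_) (+-identityʳ s) l<s+0) (n≮n s)
  least-found s (suc c) l<s+c with Q? s
  ... | yes q = q
  ... | no  _ = least-found (suc s) c (subst (least (suc s) c <_) (+-suc s c) l<s+c)

  least-minimal : ∀ s c {j} → s ≤ j → j < least s c → ¬ Q j
  least-minimal s zero    s≤j j<s = contradiction (≤-trans j<s s≤j) (n≮n _)
  least-minimal s (suc c) s≤j j<l with Q? s
  ... | yes _ = contradiction (≤-trans j<l s≤j) (n≮n _)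
  ... | no ¬q with m≤n⇒m<n∨m≡n s≤j
  ...   | inj₁ s<j  = least-minimal (suc s) c s<j j<l
  ...   | inj₂ refl = ¬q

  least-≤-witness : ∀ s c {j} → s ≤ j → Q j → least s c ≤ j
  least-≤-witness s c s≤j q = ≮⇒≥ (λ j<l → least-minimal s c s≤j j<l q)

∈-─ : ∀ {A : Set} {x y : A} {ys} (x∈ys : x ∈ ys) → y ∈ ys → y ≢ x → y ∈ (ys ─ x∈ys)
∈-─ (here refl) (here refl) y≢x = contradiction refl y≢x
∈-─ (here refl) (there y∈ys) _  = y∈ys
∈-─ (there _)   (here refl) _   = here refl
∈-─ (there x∈ys) (there y∈ys) y≢x = there (∈-─ x∈ys y∈ys y≢x)

Unique-⊆⇒length≤ : ∀ {A : Set} {xs ys : List A} → Unique xs → xs ⊆ ys → length xs ≤ length ys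
Unique-⊆⇒length≤ {xs = []} _ _ = z≤n
Unique-⊆⇒length≤ {xs = x ∷ xs} {ys} (x≢xs ∷ xs-unique) xs⊆ys =
  subst (suc (length xs) ≤_) (sym (length-removeAt′ ys (Any.index x∈ys)))
    (s≤s (Unique-⊆⇒length≤ xs-unique λ y∈xs →
      ∈-─ x∈ys (xs⊆ys (there y∈xs)) (≢-sym (All.lookup x≢xs y∈xs))))
  where x∈ys = xs⊆ys (here refl)

∀-offset : ∀ {R : ℕ → Set} d {h} → (∀ t → d + t ≤ h → R (d + t)) → ∀ i → d ≤ i → i ≤ h → R i
∀-offset {R} d f i d≤i i≤h =
  subst R (m+[n∸m]≡n d≤i) (f (i ∸ d) (subst (_≤ _) (sym (m+[n∸m]≡n d≤i)) i≤h))

Sieved : (P a : ℕ → ℕ) → List ℕ → ℕ → Set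
Sieved P a L r = Any (λ i → r ≡ a i [mod P i ]) L

sieved? : ∀ P a L r → Dec (Sieved P a L r)
sieved? P a L r = Any.any? (λ i → ≡[mod]? r (a i) (P i)) L

module _ {P : ℕ → ℕ} (P-enum : IsPrimeEnumeration P) where
  open IsPrimeEnumeration P-enum

  P-nonZero : ∀ {i} → 1 ≤ i → NonZero (P i)
  P-nonZero 1≤i = prime⇒nonZero (prime _ 1≤i)

  P-injective : ∀ {i j} → 1 ≤ i → 1 ≤ j → P i ≡ P j → i ≡ j
  P-injective {i} {j} 1≤i 1≤j Pi≡Pj with <-cmp i j
  ... | tri< i<j _ _ = contradiction Pi≡Pj (<⇒≢ (increasing i j 1≤i i<j))
  ... | tri≈ _ i≡j _ = i≡j
  ... | tri> _ _ j<i = contradiction (sym Pi≡Pj) (<⇒≢ (increasing j i 1≤j j<i))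

  residueCover⇒coveredRun : ∀ n L (b : ℕ → ℕ) →
    (∀ r → 1 ≤ r → r ≤ L → Σ ℕ λ i → 2 ≤ i × i ≤ n × r ≡ b i [mod P i ]) →
    Σ ℤ λ x → CoveredRun P n x L
  residueCover⇒coveredRun n L b cover = x , run
    where
    open ChineseRemainder (λ i → P (suc i)) (λ i → prime (suc i) (s≤s z≤n))
                          (λ e → suc-injective (P-injective (s≤s z≤n) (s≤s z≤n) e))
    solution = crt n (λ i → 1ℤ ℤ.- + b (suc i))
    x = proj₁ solution
    run : CoveredRun P n x L
    run k k<L with cover (suc k) (s≤s z≤n) k<L
    ... | suc i , 2≤i , i≤n , 1+k≡b =
      suc i , 2≤i , i≤n , ≡1-b⇒+k≡0 {x} {k} {b (suc i)} {P (suc i)} (proj₂ solution i i≤n) 1+k≡b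

  ω-cover-uses-every-index : ∀ {n m} → IsOmega P n m → (a : ℕ → ℕ) (L : List ℕ) →
    (∀ {i} → i ∈ L → 2 ≤ i × i ≤ n) → (∀ r → 1 ≤ r → r ≤ m → Sieved P a L r) →
    ∀ {j} → 2 ≤ j → j ≤ n → j ∈ L
  ω-cover-uses-every-index {n} {m} (_ , maximal) a L L⊆[2,n] sieved {j} 2≤j j≤n with j ∈? L
  ... | yes j∈L = j∈L
  ... | no  j∉L = contradiction (maximal (proj₁ longerRun) (suc m) (proj₂ longerRun)) (n≮n m)
    where
    -- the unused index j is spent on m + 1
    b : ℕ → ℕ
    b i with i ≟ j
    ... | yes _ = suc m
    ... | no  _ = a i
    b-j : b j ≡ suc m
    b-j with j ≟ j
    ... | yes _  = refl
    ... | no j≢j = contradiction refl j≢j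
    b-other : ∀ {i} → i ≢ j → b i ≡ a i
    b-other {i} i≢j with i ≟ j
    ... | yes i≡j = contradiction i≡j i≢j
    ... | no  _   = refl
    cover : ∀ r → 1 ≤ r → r ≤ suc m → Σ ℕ λ i → 2 ≤ i × i ≤ n × r ≡ b i [mod P i ]
    cover r 1≤r r≤1+m with m≤n⇒m<n∨m≡n r≤1+m
    ... | inj₂ refl = j , 2≤j , j≤n , subst (λ z → suc m ≡ z [mod P j ]) (sym b-j) (≡ᶻ-refl {+ suc m} {P j})
    ... | inj₁ (s≤s r≤m) with find (sieved r 1≤r r≤m)
    ...   | i , i∈L , r≡ai = i , proj₁ (L⊆[2,n] i∈L) , proj₂ (L⊆[2,n] i∈L) ,
                             subst (λ z → r ≡ z [mod P i ]) (sym (b-other (λ { refl → j∉L i∈L }))) r≡ai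
    longerRun : Σ ℤ λ x → CoveredRun P n x (suc m)
    longerRun = residueCover⇒coveredRun n (suc m) b cover

module Greedy {P : ℕ → ℕ} (P-enum : IsPrimeEnumeration P) (k m : ℕ) (ω : IsOmega P (2 + k) m)
  (a : ℕ → ℕ) (a-range : ∀ i → 2 ≤ i → i ≤ 2 + k → 1 ≤ a i × a i ≤ P i ∸ 1)
  (a-cover : ∀ r → 1 ≤ r → r ≤ m → Σ ℕ λ i → 2 ≤ i × i ≤ 2 + k × r ≡ a i [mod P i ]) where

  n : ℕ
  n = 2 + k

  indices : List ℕ
  indices = applyUpTo (λ e → 2 + e) (suc k)

  ∈-indices⁺ : ∀ {j} → 2 ≤ j → j ≤ n → j ∈ indices
  ∈-indices⁺ {1}           (s≤s ()) _
  ∈-indices⁺ {suc (suc e)} _        (s≤s (s≤s e≤k)) = ∈-applyUpTo⁺ (λ e → 2 + e) (s≤s e≤k)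

  ∈-indices⁻ : ∀ {j} → j ∈ indices → 2 ≤ j × j ≤ n
  ∈-indices⁻ j∈ with ∈-applyUpTo⁻ (λ e → 2 + e) j∈
  ... | e , s≤s e≤k , refl = s≤s (s≤s z≤n) , s≤s (s≤s e≤k)

  length-indices : length indices ≡ suc k
  length-indices = length-applyUpTo (λ e → 2 + e) (suc k)

  indices-unique : Unique indices
  indices-unique = applyUpTo⁺₁ (λ e → 2 + e) (suc k) λ i<j _ → <⇒≢ (s≤s (s≤s i<j))

  module ValueSearch (L : List ℕ) = BoundedSearch (λ r → ¬? (sieved? P a L r))

  nextValue : List ℕ → ℕ
  nextValue L = ValueSearch.least L 1 m

  module IndexSearch (L : List ℕ) = BoundedSearch (λ i → ≡[mod]? (nextValue L) (a i) (P i))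

  nextIndex : List ℕ → ℕ
  nextIndex L = IndexSearch.least L 2 (suc k)

  chosen : ℕ → List ℕ
  chosen zero    = []
  chosen (suc t) = nextIndex (chosen t) ∷ chosen t

  value index : ℕ → ℕ
  value t = nextValue (chosen t)
  index t = nextIndex (chosen t)

  value-≥1 : ∀ t → 1 ≤ value t
  value-≥1 t = ValueSearch.least-≥ (chosen t) 1 m

  index-≥2 : ∀ t → 2 ≤ index t
  index-≥2 t = IndexSearch.least-≥ (chosen t) 2 (suc k)

  below-value-sieved : ∀ t {r} → 1 ≤ r → r < value t → Sieved P a (chosen t) r
  below-value-sieved t 1≤r r<value =
    decidable-stable (sieved? P a (chosen t) _) (ValueSearch.least-minimal (chosen t) 1 m 1≤r r<value)

  ∈-chosen⁻ : ∀ t {i} → i ∈ chosen t → ∃ λ u → u < t × i ≡ index u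
  ∈-chosen⁻ (suc t) (here i≡) = t , ≤-refl , i≡
  ∈-chosen⁻ (suc t) (there i∈) with ∈-chosen⁻ t i∈
  ... | u , u<t , i≡ = u , m≤n⇒m≤1+n u<t , i≡

  ∈-chosen⁺ : ∀ {u t} → u < t → index u ∈ chosen t
  ∈-chosen⁺ {u} {suc t} (s≤s u≤t) with m≤n⇒m<n∨m≡n u≤t
  ... | inj₁ u<t  = there (∈-chosen⁺ u<t)
  ... | inj₂ refl = here refl

  chosen-mono : ∀ {u t} → u ≤ t → chosen u ⊆ chosen t
  chosen-mono {u} u≤t i∈ with ∈-chosen⁻ u i∈
  ... | v , v<u , refl = ∈-chosen⁺ (<-≤-trans v<u u≤t)

  length-chosen : ∀ t → length (chosen t) ≡ t
  length-chosen zero    = refl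
  length-chosen (suc t) = cong suc (length-chosen t)

  -- Otherwise the t ≤ k chosen classes sieve all of [1, m], and ω-cover-uses-every-index
  -- puts all k + 1 indices among them.
  value-≤m-if-chosen⊆indices : ∀ t → t ≤ k → chosen t ⊆ indices → value t ≤ m
  value-≤m-if-chosen⊆indices t t≤k chosen⊆indices = ≮⇒≥ λ m<value → n≮n t (begin-strict
      t                   ≤⟨ t≤k ⟩
      k                   <⟨ n<1+n k ⟩
      suc k               ≡⟨ length-indices ⟨
      length indices      ≤⟨ Unique-⊆⇒length≤ indices-unique (indices⊆chosen m<value) ⟩
      length (chosen t)   ≡⟨ length-chosen t ⟩
      t                   ∎)
    where
    open ≤-Reasoning
    indices⊆chosen : m < value t → indices ⊆ chosen t
    indices⊆chosen m<value j∈ =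
      ω-cover-uses-every-index P-enum ω a (chosen t) (∈-indices⁻ ∘ chosen⊆indices)
        (λ r 1≤r r≤m → below-value-sieved t 1≤r (≤-<-trans r≤m m<value))
        (proj₁ (∈-indices⁻ j∈)) (proj₂ (∈-indices⁻ j∈))

  index-found : ∀ t → value t ≤ m → index t ≤ n × value t ≡ a (index t) [mod P (index t) ]
  index-found t value≤m with a-cover (value t) (value-≥1 t) value≤m
  ... | i , 2≤i , i≤n , value≡ai = index≤n , IndexSearch.least-found (chosen t) 2 (suc k) (s≤s index≤n)
    where
    index≤n : index t ≤ n
    index≤n = ≤-trans (IndexSearch.least-≤-witness (chosen t) 2 (suc k) 2≤i value≡ai) i≤n

  chosen-⊆ : ∀ t → t ≤ suc k → chosen t ⊆ indices
  chosen-⊆ (suc t) (s≤s t≤k) (here refl) =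
    ∈-indices⁺ (index-≥2 t)
      (proj₁ (index-found t (value-≤m-if-chosen⊆indices t t≤k (chosen-⊆ t (m≤n⇒m≤1+n t≤k)))))
  chosen-⊆ (suc t) (s≤s t≤k) (there i∈) = chosen-⊆ t (m≤n⇒m≤1+n t≤k) i∈

  value-≤m : ∀ t → t ≤ k → value t ≤ m
  value-≤m t t≤k = value-≤m-if-chosen⊆indices t t≤k (chosen-⊆ t (m≤n⇒m≤1+n t≤k))

  value-unsieved : ∀ t → t ≤ k → ¬ Sieved P a (chosen t) (value t)
  value-unsieved t t≤k = ValueSearch.least-found (chosen t) 1 m (s≤s (value-≤m t t≤k))

  index-≤n : ∀ t → t ≤ k → index t ≤ n
  index-≤n t t≤k = proj₁ (index-found t (value-≤m t t≤k))

  value≡a[index] : ∀ t → t ≤ k → value t ≡ a (index t) [mod P (index t) ]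
  value≡a[index] t t≤k = proj₂ (index-found t (value-≤m t t≤k))

  index-fresh : ∀ t → t ≤ k → index t ∉ chosen t
  index-fresh t t≤k i∈ = value-unsieved t t≤k (lose i∈ (value≡a[index] t t≤k))

  chosen-unique : ∀ t → t ≤ suc k → Unique (chosen t)
  chosen-unique zero    _         = []
  chosen-unique (suc t) (s≤s t≤k) = ¬Any⇒All¬ _ (index-fresh t t≤k) ∷ chosen-unique t (m≤n⇒m≤1+n t≤k)

  index-injective : ∀ {u v} → u ≤ k → v ≤ k → index u ≡ index v → u ≡ v
  index-injective {u} {v} u≤k v≤k eq with <-cmp u v
  ... | tri< u<v _ _ = contradiction (subst (_∈ chosen v) eq (∈-chosen⁺ u<v)) (index-fresh v v≤k)
  ... | tri≈ _ u≡v _ = u≡v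
  ... | tri> _ _ v<u = contradiction (subst (_∈ chosen u) (sym eq) (∈-chosen⁺ v<u)) (index-fresh u u≤k)

  indices⊆chosen : indices ⊆ chosen (suc k)
  indices⊆chosen {j} j∈ with j ∈? chosen (suc k)
  ... | yes j∈chosen = j∈chosen
  ... | no  j∉chosen = contradiction
          (subst₂ _≤_ (cong suc (length-chosen (suc k))) length-indices
            (Unique-⊆⇒length≤ (¬Any⇒All¬ _ j∉chosen ∷ chosen-unique (suc k) ≤-refl) j∷chosen⊆indices))
          (n≮n (suc k))
    where
    j∷chosen⊆indices : j ∷ chosen (suc k) ⊆ indices
    j∷chosen⊆indices (here refl) = j∈
    j∷chosen⊆indices (there i∈)  = chosen-⊆ (suc k) ≤-refl i∈

  index-surjective : ∀ {j} → 2 ≤ j → j ≤ n → ∃ λ u → u ≤ k × j ≡ index u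
  index-surjective 2≤j j≤n with ∈-chosen⁻ (suc k) (indices⊆chosen (∈-indices⁺ 2≤j j≤n))
  ... | u , s≤s u≤k , j≡ = u , u≤k , j≡

  value-increasing : ∀ {u v} → u < v → v ≤ k → value u < value v
  value-increasing {u} {v} u<v v≤k = ≤∧≢⇒< value-u≤v value-u≢v
    where
    u≤k = ≤-trans (<⇒≤ u<v) v≤k
    value-u≤v : value u ≤ value v
    value-u≤v = ≮⇒≥ λ v<u → value-unsieved v v≤k
      (Any-resp-⊆ (chosen-mono (<⇒≤ u<v)) (below-value-sieved u (value-≥1 v) v<u))
    value-u≢v : value u ≢ value v
    value-u≢v eq = value-unsieved v v≤k
      (lose (∈-chosen⁺ u<v) (subst (λ z → z ≡ a (index u) [mod P (index u) ]) eq (value≡a[index] u u≤k)))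

  sieved⇒≡value : ∀ {t r} → t ≤ suc k → Sieved P a (chosen t) r →
                  ∃ λ u → u < t × r ≡ value u [mod P (index u) ]
  sieved⇒≡value {t} {r} t≤1+k sieved with find sieved
  ... | i , i∈ , r≡ai with ∈-chosen⁻ t i∈
  ...   | u , u<t , refl = u , u<t ,
          ≡ᶻ-trans {+ r} {+ a (index u)} {+ value u} {P (index u)} r≡ai
            (≡ᶻ-sym {+ value u} {+ a (index u)} (value≡a[index] u (≤-pred (≤-trans u<t t≤1+k))))

  ≡value⇒sieved : ∀ {t u r} → u < t → t ≤ suc k → r ≡ value u [mod P (index u) ] → Sieved P a (chosen t) r
  ≡value⇒sieved {t} {u} {r} u<t t≤1+k r≡value = lose (∈-chosen⁺ u<t)
    (≡ᶻ-trans {+ r} {+ value u} {+ a (index u)} {P (index u)} r≡value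
      (value≡a[index] u (≤-pred (≤-trans u<t t≤1+k))))

  π q : ℕ → ℕ
  π i = P (index (i ∸ 2))
  q i = value (i ∸ 2)

  private
    offset≤ : ∀ {t} → 2 + t ≤ n → t ≤ k
    offset≤ = +-cancelˡ-≤ 2 _ _

  π-permutes : IsPermOfPrimes P n π
  π-permutes = π-range , π-injective , π-onto
    where
    π-range : ∀ i → 2 ≤ i → i ≤ n → Σ ℕ λ j → 2 ≤ j × j ≤ n × π i ≡ P j
    π-range = ∀-offset 2 λ t 2+t≤n → index t , index-≥2 t , index-≤n t (offset≤ 2+t≤n) , refl
    π-injective : ∀ i j → 2 ≤ i → i ≤ n → 2 ≤ j → j ≤ n → π i ≡ π j → i ≡ j
    π-injective 1 _ (s≤s ()) _ _ _ _
    π-injective _ 1 _ _ (s≤s ()) _ _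
    π-injective (suc (suc t)) (suc (suc u)) _ 2+t≤n _ 2+u≤n πt≡πu =
      cong (λ e → 2 + e) (index-injective (offset≤ 2+t≤n) (offset≤ 2+u≤n)
        (P-injective P-enum (≤-trans (s≤s z≤n) (index-≥2 t)) (≤-trans (s≤s z≤n) (index-≥2 u)) πt≡πu))
    π-onto : ∀ j → 2 ≤ j → j ≤ n → Σ ℕ λ i → 2 ≤ i × i ≤ n × π i ≡ P j
    π-onto j 2≤j j≤n with index-surjective 2≤j j≤n
    ... | u , u≤k , j≡index = 2 + u , s≤s (s≤s z≤n) , s≤s (s≤s u≤k) , cong P (sym j≡index)

  value-isMin : ∀ t → t ≤ k → IsMin (Avoids π q m (2 + t)) (value t)
  value-isMin t t≤k =
    (value-≥1 t , value-≤m t t≤k , unsieved⇒avoids (value-unsieved t t≤k)) ,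
    λ r (1≤r , _ , avoids) → ≮⇒≥ λ r<value → avoids⇒unsieved avoids (below-value-sieved t 1≤r r<value)
    where
    t≤1+k = m≤n⇒m≤1+n t≤k
    unsieved⇒avoids : ∀ {r} → ¬ Sieved P a (chosen t) r →
                      ∀ i → 2 ≤ i → i < 2 + t → ¬ r ≡ q i [mod π i ]
    unsieved⇒avoids _       1             (s≤s ()) _
    unsieved⇒avoids ¬sieved (suc (suc u)) _ (s≤s (s≤s u<t)) r≡value =
      ¬sieved (≡value⇒sieved u<t t≤1+k r≡value)
    avoids⇒unsieved : ∀ {r} → (∀ i → 2 ≤ i → i < 2 + t → ¬ r ≡ q i [mod π i ]) →
                      ¬ Sieved P a (chosen t) r
    avoids⇒unsieved avoids sieved with sieved⇒≡value t≤1+k sieved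
    ... | u , u<t , r≡value = avoids (2 + u) (s≤s (s≤s z≤n)) (s≤s (s≤s u<t)) r≡value

  statement3 : Statement3 P n m
  statement3 = π , q , π-permutes , q-range , q≢0 , q-increasing , q₂≡1 , q-minimal , q-cover
    where
    q-range : ∀ i → 2 ≤ i → i ≤ n → 1 ≤ q i × q i ≤ m
    q-range = ∀-offset 2 λ t 2+t≤n → value-≥1 t , value-≤m t (offset≤ 2+t≤n)
    q≢0 : ∀ i → 2 ≤ i → i ≤ n → ¬ (q i ≡ 0 [mod π i ])
    q≢0 = ∀-offset 2 λ t 2+t≤n q≡0 →
      let t≤k = offset≤ 2+t≤n
          s = index t
          a-bounds = a-range s (index-≥2 t) (index-≤n t t≤k)
      in residue≢0 (proj₁ a-bounds) (proj₂ a-bounds)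
           (≡ᶻ-trans {+ a s} {+ value t} {+ 0} {P s} (≡ᶻ-sym {+ value t} {+ a s} (value≡a[index] t t≤k)) q≡0)
    q-increasing : ∀ i j → 2 ≤ i → i ≤ n → 2 ≤ j → j ≤ n → i < j → q i < q j
    q-increasing 1 _ (s≤s ()) _ _ _ _
    q-increasing _ 1 _ _ (s≤s ()) _ _
    q-increasing (suc (suc t)) (suc (suc u)) _ _ _ 2+u≤n (s≤s (s≤s t<u)) =
      value-increasing t<u (offset≤ 2+u≤n)
    q₂≡1 : q 2 ≡ 1
    q₂≡1 = ≤-antisym (ValueSearch.least-≤-witness [] 1 m ≤-refl λ ()) (value-≥1 0)
    q-minimal : ∀ i → 3 ≤ i → i ≤ n → IsMin (Avoids π q m i) (q i)
    q-minimal = ∀-offset 3 λ t 3+t≤n → value-isMin (suc t) (offset≤ 3+t≤n)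
    q-cover : ∀ r → 1 ≤ r → r ≤ m → Σ ℕ λ i → 2 ≤ i × i ≤ n × r ≡ q i [mod π i ]
    q-cover r 1≤r r≤m with a-cover r 1≤r r≤m
    ... | j , 2≤j , j≤n , r≡aj with sieved⇒≡value ≤-refl (lose (indices⊆chosen (∈-indices⁺ 2≤j j≤n)) r≡aj)
    ...   | u , s≤s u≤k , r≡value = 2 + u , s≤s (s≤s z≤n) , s≤s (s≤s u≤k) , r≡value

module Residues {P : ℕ → ℕ} (P-enum : IsPrimeEnumeration P) (k m : ℕ) (π q : ℕ → ℕ)
  (π-range : ∀ i → 2 ≤ i → i ≤ 2 + k → Σ ℕ λ j → 2 ≤ j × j ≤ 2 + k × π i ≡ P j)
  (π-injective : ∀ i j → 2 ≤ i → i ≤ 2 + k → 2 ≤ j → j ≤ 2 + k → π i ≡ π j → i ≡ j)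
  (π-onto : ∀ j → 2 ≤ j → j ≤ 2 + k → Σ ℕ λ i → 2 ≤ i × i ≤ 2 + k × π i ≡ P j)
  (q≢0 : ∀ i → 2 ≤ i → i ≤ 2 + k → ¬ (q i ≡ 0 [mod π i ]))
  (q-cover : ∀ r → 1 ≤ r → r ≤ m → Σ ℕ λ i → 2 ≤ i × i ≤ 2 + k × r ≡ q i [mod π i ]) where

  n : ℕ
  n = 2 + k

  module PreimageSearch (j : ℕ) = BoundedSearch (λ i → π i ≟ P j)

  preimage : ℕ → ℕ
  preimage j = PreimageSearch.least j 2 (suc k)

  preimage-spec : ∀ {j} → 2 ≤ j → j ≤ n → 2 ≤ preimage j × preimage j ≤ n × π (preimage j) ≡ P j
  preimage-spec {j} 2≤j j≤n with π-onto j 2≤j j≤n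
  ... | i , 2≤i , i≤n , πi≡Pj =
    PreimageSearch.least-≥ j 2 (suc k) , preimage≤n , PreimageSearch.least-found j 2 (suc k) (s≤s preimage≤n)
    where
    preimage≤n : preimage j ≤ n
    preimage≤n = ≤-trans (PreimageSearch.least-≤-witness j 2 (suc k) 2≤i πi≡Pj) i≤n

  -- P 0 is unconstrained (it may be 0), so a is split on j to have a nonzero modulus.
  a : ℕ → ℕ
  a zero    = 0
  a (suc j) = q (preimage (suc j)) % P (suc j)
    where instance _ = P-nonZero P-enum {suc j} (s≤s z≤n)

  q≡a : ∀ {j} → 1 ≤ j → q (preimage j) ≡ a j [mod P j ]
  q≡a {suc j} 1≤j = ≡%[mod] (q (preimage (suc j))) (P (suc j)) {{P-nonZero P-enum 1≤j}}

  a-range : ∀ j → 2 ≤ j → j ≤ n → 1 ≤ a j × a j ≤ P j ∸ 1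
  a-range (suc j) 2≤j j≤n = n≢0⇒n>0 a≢0 , ∸-monoˡ-≤ 1 (m%n<n _ (P (suc j)) {{P-nonZero P-enum (s≤s z≤n)}})
    where
    i = preimage (suc j)
    a≢0 : a (suc j) ≢ 0
    a≢0 a≡0 with preimage-spec 2≤j j≤n
    ... | 2≤i , i≤n , πi≡Pj =
      q≢0 i 2≤i i≤n (subst₂ (λ z d → q i ≡ z [mod d ]) a≡0 (sym πi≡Pj) (q≡a (s≤s z≤n)))

  a-cover : ∀ r → 1 ≤ r → r ≤ m → Σ ℕ λ j → 2 ≤ j × j ≤ n × r ≡ a j [mod P j ]
  a-cover r 1≤r r≤m with q-cover r 1≤r r≤m
  ... | i , 2≤i , i≤n , r≡qi with π-range i 2≤i i≤n
  ...   | j , 2≤j , j≤n , πi≡Pj with preimage-spec 2≤j j≤n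
  ...     | 2≤i′ , i′≤n , πi′≡Pj with π-injective _ i 2≤i′ i′≤n 2≤i i≤n (trans πi′≡Pj (sym πi≡Pj))
  ...       | refl = j , 2≤j , j≤n ,
    ≡ᶻ-trans {+ r} {+ q i} {+ a j} {P j} (subst (λ d → r ≡ q i [mod d ]) πi≡Pj r≡qi)
      (q≡a (≤-trans (s≤s z≤n) 2≤j))

  statement2 : Statement2 P n m
  statement2 = a , a-range , a-cover

proposition1p12 : (P : ℕ → ℕ) → IsPrimeEnumeration P →
    (m n : ℕ) → 1 < n → IsOmega P n m →
    Statement2 P n m ⇔ Statement3 P n m
proposition1p12 P P-enum m 1 (s≤s ()) ω
proposition1p12 P P-enum m (suc (suc k)) _ ω = mk⇔
  (λ (a , a-range , a-cover) → Greedy.statement3 P-enum k m ω a a-range a-cover)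
  (λ (π , q , (π-range , π-injective , π-onto) , _ , q≢0 , _ , _ , _ , q-cover) →
     Residues.statement2 P-enum k m π q π-range π-injective π-onto q≢0 q-cover)
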